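{- For every $n \geq 1$, consider the QBF $\Phi_C(n) := \Pi_C(n).\psi_C(n)$ with prefix $\Pi_C(n) := \exists B_1 \forall B_2 \exists B_3 \forall B_4 \exists B_5$, where $B_1 := \{x_{4i+1}, x_{4i+2} \mid 0 \le i < n\}$, $B_2 := \{u_{2i+1} \mid 0 \le i<n\}$, $B_3 := \{x_{4i+3} \mid 0\le i<n\}$, $B_4 := \{u_{2i+2} \mid 0\le i<n\}$, $B_5 := \{x_{4i+4} \mid 0 \le i < n\}$, and CNF $\psi_C(n) := \bigwedge_{i=0}^{n-1}\bigwedge_{j=0}^{6} C_{i,j}$ with $C_{i,0} := (x_{4i+1} \vee u_{2i+1} \vee \neg x_{4i+3})$, $C_{i,1} := (x_{4i+2} \vee \neg u_{2i+1} \vee x_{4i+3})$, $C_{i,2} := (\neg x_{4i+1} \vee \neg u_{2i+1} \vee \neg x_{4i+3})$, $C_{i,3} := (\neg x_{4i+2} \vee u_{2i+1} \vee x_{4i+3})$, $C_{i,4} := (u_{2i+1} \vee \neg x_{4i+3} \vee x_{4i+4})$, $C_{i,5} := (\neg u_{2i+2} \vee \neg x_{4i+4})$, $C_{i,6} := (\neg x_{4i+1} \vee u_{2i+2} \vee \neg x_{4i+4})$. Then (a) there is a finite sequence of $\mathsf{QRATE}^{+}$ steps transforming $\Phi_C(n)$ into a QBF with empty matrix (all clauses eliminated); and (b) no clause of $\Phi_C(n)$ can be eliminated by a $\mathsf{QRATE}$ step, i.e., there is no clause $C \in \psi_C(n)$ and existential literal $l \in C$ such that $C$ has property $\mathsf{QRAT}$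 on $l$ with respect to $\Pi_C(n).(\psi_C(n)\setminus\{C\})$.
   Context: QBF basics: $\Pi = Q_1B_1\ldots Q_mB_m$ with disjoint variable blocks, alternating quantifiers, last one $\exists$; a literal is existential/universal according to its block's quantifier; $\leq_\Pi$ orders literals by block index, refined by a fixed total order of variables within each block. For a clause $C$, $\mathrm{levels}(\Pi,C)$ is the set of indices $i$ such that some literal of $C$ has its variable in $B_i$. Tree semantics: in the assignment tree (internal nodes associated with variables in the order $\leq_\Pi$, two children per node for the two values), a pre-model is a subtree containing the root with both children of every universal node and exactly one child of every existential node; a model of $\Pi.\chi$ is a pre-model all of whose root-to-leaf paths (complete assignments) satisfy $\chi$. $\Pi.\chi \models_t \Pi.\chi'$ means every model of $\Pi.\chi$ is a model of $\Pi.\chi'$. Abstraction: $\mathit{Abs}(\Pi,0) := \Pi$, and for $1\le i\le m$, $\mathit{Abs}(\Pi,i) := \exists(B_1\cup\dots\cup B_i)\,Q_{i+1}B_{i+1}\ldots Q_mB_m$ (adjacent blocks with the same quantifier are merged; the variable order is unchanged); $\mathit{Abs}(\Pi.\chi,i) := \mathit{Abs}(\Pi,i).\chi$. Universal reduction: $\mathit{UR}(\Pi,C) := C \setminus \{l \in C \mid l \text{ universal and } \mathrm{var}(l') \le_\Pi \mathrm{var}(l) \text{ for all existential } l' \in C\}$. Unit propagation (UP) on a CNF $\chi$: starting from the empty assignment $\sigma$, repeatedly take a clause not satisfied by $\sigma$, delete its literals falsified by $\sigma$; if it becomes empty, UP derives the empty clause; if it becomes a single literal $k$, add $k$ to $\sigma$.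 QBF unit propagation (QUP) on $\Pi.\chi$ is the same, except that after deleting falsified literals, $\mathit{UR}$ w.r.t. $\Pi$ is applied to the clause before testing for empty/unit. For a clause $C$, $\overline{C}$ denotes the conjunction of unit clauses $(\bar k)$, $k \in C$. Outer clause $\mathsf{OC}(\Pi,D,k) := \{k'\in D \mid k' \le_\Pi k, k'\neq k\}$; outer resolvent $\mathsf{OR}(\Pi,C,D,l) := (C\setminus\{l\})\cup \mathsf{OC}(\Pi,D,\bar l)$ for $l\in C$, $\bar l \in D$. $\mathsf{AT}$: clause $E$ has $\mathsf{AT}$ w.r.t. CNF $\chi$ iff UP on $\chi\wedge\overline{E}$ derives the empty clause. $\mathsf{QAT}$: with $i := \max(\mathrm{levels}(\Pi,E))$, clause $E$ has $\mathsf{QAT}$ w.r.t. $\Pi.\chi$ iff QUP on $\mathit{Abs}(\Pi,i).(\chi\wedge\overline{E})$ derives the empty clause and $\mathit{Abs}(\Pi.\chi,i) \models_t \mathit{Abs}(\Pi.(\chi\wedge E),i)$. $C$ has $\mathsf{QRAT}$ (resp. $\mathsf{QRAT}^{+}$) on $l \in C$ w.r.t. $\Pi.\chi$ iff for every $D \in \chi$ with $\bar l \in D$, $\mathsf{OR}(\Pi,C,D,l)$ has $\mathsf{AT}$ w.r.t. $\chi$ (resp. has $\mathsf{QAT}$ w.r.t. $\Pi.\chi$). A $\mathsf{QRATE}$ (resp. $\mathsf{QRATE}^{+}$) step transforms $\Pi.\chi$ into $\Pi.(\chi\setminus\{C\})$ for some $C \in \chi$ that has $\mathsf{QRAT}$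 (resp. $\mathsf{QRAT}^{+}$) on some existential literal $l\in C$ w.r.t. $\Pi.(\chi\setminus\{C\})$; the prefix is kept unchanged. -}

module Defs where

open import Data.Bool using (Bool; true; false; _∧_; _∨_; not; if_then_else_)
open import Data.Nat using (ℕ; zero; suc; _+_; _*_; _≤ᵇ_; _⊔_)
import Data.Nat.Properties as ℕP
open import Data.List using (List; []; _∷_; _++_; [_]; map; concatMap; filter; filterᵇ; foldr; upTo; length)
open import Data.Bool.ListAction using (any; all)
open import Data.List.Membership.Propositional using (_∈_)
import Data.List.Properties as LP
open import Data.Product using (Σ; _×_; _,_)
open import Relation.Binary.PropositionalEquality using (_≡_; refl; cong)
open import Relation.Nullary using (Dec; yes; no; ¬_; ¬?)
open import Relation.Nullary.Decidable using (⌊_⌋)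
open import Relation.Binary.Construct.Closure.ReflexiveTransitive using (Star)

data Var : Set where
  x : ℕ → Var
  u : ℕ → Var

_≟V_ : (v w : Var) → Dec (v ≡ w)
x m ≟V x n with m ℕP.≟ n
... | yes refl = yes refl
... | no p = no (λ { refl → p refl })
x m ≟V u n = no (λ ())
u m ≟V x n = no (λ ())
u m ≟V u n with m ℕP.≟ n
... | yes refl = yes refl
... | no p = no (λ { refl → p refl })

data Lit : Set where
  pos : Var → Lit
  neg : Var → Lit

var : Lit → Var
var (pos v) = v
var (neg v) = v

~_ : Lit → Lit
~ pos v = neg v
~ neg v = pos v

_≟L_ : (l k : Lit) → Dec (l ≡ k)
pos v ≟L pos w with v ≟V w
... | yes refl = yes refl
... | no p = no (λ { refl → p refl })
pos v ≟L neg w = no (λ ())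
neg v ≟L pos w = no (λ ())
neg v ≟L neg w with v ≟V w
... | yes refl = yes refl
... | no p = no (λ { refl → p refl })

Clause : Set
Clause = List Lit

CNF : Set
CNF = List Clause

_≟C_ : (C D : Clause) → Dec (C ≡ D)
_≟C_ = LP.≡-dec _≟L_

_∈ᵇ_ : Lit → List Lit → Bool
l ∈ᵇ ks = any (λ k → ⌊ l ≟L k ⌋) ks

-- χ ∖ {C}  (set difference: remove every copy of C)
_∖[_] : CNF → Clause → CNF
χ ∖[ C ] = filter (λ D → ¬? (D ≟C C)) χ

data Quant : Set where
  ∃q ∀q : Quant

-- a prefix Q₁B₁ … QₘBₘ is a list of blocks; the order of variables inside
-- a block is the order of the list
Prefix : Set
Prefix = List (Quant × List Var)

qvars : Prefix → List (Quant × Var)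
qvars [] = []
qvars ((q , vs) ∷ bs) = map (λ v → (q , v)) vs ++ qvars bs

-- position of a variable in the order ≤_Π
-- (variables not occurring in the prefix get the position after all others;
--  this never happens for the formulas considered below)
position : List (Quant × Var) → Var → ℕ
position [] v = 0
position ((q , w) ∷ qs) v with v ≟V w
... | yes _ = 0
... | no _ = suc (position qs v)

_≤[_]_ : Lit → Prefix → Lit → Bool
l ≤[ Π ] k = position (qvars Π) (var l) ≤ᵇ position (qvars Π) (var k)

-- quantifier of a variable (variables not in the prefix: existential)
quantOf : Prefix → Var → Quant
quantOf Π v = go (qvars Π)
  where
  go : List (Quant × Var) → Quant
  go [] = ∃q
  go ((q , w) ∷ qs) with v ≟V w
  ... | yes _ = q
  ... | no _ = go qs

isExistential : Prefix → Lit → Bool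
isExistential Π l with quantOf Π (var l)
... | ∃q = true
... | ∀q = false

isUniversal : Prefix → Lit → Bool
isUniversal Π l = not (isExistential Π l)

-- block index (1-based) of a variable (0 if it does not occur)
blockOf : Prefix → Var → ℕ
blockOf Π v = go 1 Π
  where
  go : ℕ → Prefix → ℕ
  go i [] = 0
  go i ((q , vs) ∷ bs) = if any (λ w → ⌊ v ≟V w ⌋) vs then i else go (suc i) bs

-- max(levels(Π, C))  (0 for the empty clause)
maxLevel : Prefix → Clause → ℕ
maxLevel Π C = foldr (λ l m → blockOf Π (var l) ⊔ m) 0 C

-- Adjacent blocks with
-- the same quantifier are not merged syntactically; merging does not
-- change the variable order nor any quantifier, which is all that the
-- notions below depend on.
Abs : Prefix → ℕ → Prefix
Abs Π zero = Π
Abs [] (suc i) = []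
Abs ((q , vs) ∷ bs) (suc i) = (∃q , vs) ∷ Abs bs i

UR : Prefix → Clause → Clause
UR Π C = filterᵇ (λ l → not (reducible l)) C
  where
  reducible : Lit → Bool
  reducible l = isUniversal Π l
                ∧ all (λ l' → not (isExistential Π l') ∨ (l' ≤[ Π ] l)) C

satisfies : List Lit → Clause → Bool
satisfies σ C = any (λ k → k ∈ᵇ σ) C

dropFalsified : List Lit → Clause → Clause
dropFalsified σ C = filterᵇ (λ k → not ((~ k) ∈ᵇ σ)) C

-- "UP with post-processing red derives the empty clause on χ, starting
-- from the partial assignment σ" (some run of the propagation reaches the
-- empty clause).
data Derives⊥ (red : Clause → Clause) (χ : CNF) : List Lit → Set where
  conflict : ∀ {σ C} → C ∈ χ → satisfies σ C ≡ false →
             red (dropFalsified σ C) ≡ [] → Derives⊥ red χ σ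
  unit     : ∀ {σ C k} → C ∈ χ → satisfies σ C ≡ false →
             red (dropFalsified σ C) ≡ k ∷ [] →
             Derives⊥ red χ (k ∷ σ) → Derives⊥ red χ σ

UP⊥ : CNF → Set
UP⊥ χ = Derives⊥ (λ C → C) χ []

QUP⊥ : Prefix → CNF → Set
QUP⊥ Π χ = Derives⊥ (UR Π) χ []

negUnits : Clause → CNF
negUnits C = map (λ k → [ ~ k ]) C

data PreModel : List (Quant × Var) → Set where
  leaf  : PreModel []
  ∀node : ∀ {v qs} → PreModel qs → PreModel qs → PreModel ((∀q , v) ∷ qs)
  ∃node : ∀ {v qs} → (b : Bool) → PreModel qs → PreModel ((∃q , v) ∷ qs)

lit : Var → Bool → Lit
lit v true = pos v
lit v false = neg v

-- every root-to-leaf path (as the set of true literals, accumulated in σ)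
-- satisfies P
AllPaths : ∀ {qs} → (List Lit → Set) → List Lit → PreModel qs → Set
AllPaths P σ leaf = P σ
AllPaths P σ (∀node {v} t₀ t₁) = AllPaths P (lit v false ∷ σ) t₀ × AllPaths P (lit v true ∷ σ) t₁
AllPaths P σ (∃node {v} b t) = AllPaths P (lit v b ∷ σ) t

satisfiesCNF : List Lit → CNF → Bool
satisfiesCNF σ χ = all (satisfies σ) χ

IsModel : (Π : Prefix) → CNF → PreModel (qvars Π) → Set
IsModel Π χ t = AllPaths (λ σ → satisfiesCNF σ χ ≡ true) [] t

_∙_⊨t_ : Prefix → CNF → CNF → Set
Π ∙ χ ⊨t χ' = (t : PreModel (qvars Π)) → IsModel Π χ t → IsModel Π χ' t

OC : Prefix → Clause → Lit → Clause
OC Π D k = filterᵇ (λ k' → (k' ≤[ Π ] k) ∧ not ⌊ k' ≟L k ⌋) D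

OR : Prefix → Clause → Clause → Lit → Clause
OR Π C D l = filterᵇ (λ k → not ⌊ k ≟L l ⌋) C ++ OC Π D (~ l)

AT : Clause → CNF → Set
AT E χ = UP⊥ (χ ++ negUnits E)

QAT : Prefix → Clause → CNF → Set
QAT Π E χ = QUP⊥ (Abs Π i) (χ ++ negUnits E)
          × (Abs Π i ∙ χ ⊨t (χ ++ E ∷ []))
  where i = maxLevel Π E

QRAT : Prefix → CNF → Clause → Lit → Set
QRAT Π χ C l = ∀ D → D ∈ χ → (~ l) ∈ D → AT (OR Π C D l) χ

QRAT⁺ : Prefix → CNF → Clause → Lit → Set
QRAT⁺ Π χ C l = ∀ D → D ∈ χ → (~ l) ∈ D → QAT Π (OR Π C D l) (χ)

data QRATE⁺-step (Π : Prefix) : CNF → CNF → Set where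
  step : ∀ {χ} C l → C ∈ χ → l ∈ C → isExistential Π l ≡ true →
         QRAT⁺ Π (χ ∖[ C ]) C l → QRATE⁺-step Π χ (χ ∖[ C ])

_⊢_⟶*_ : Prefix → CNF → CNF → Set
Π ⊢ χ ⟶* χ' = Star (QRATE⁺-step Π) χ χ'

QRATE-eliminable : Prefix → CNF → Set
QRATE-eliminable Π χ =
  Σ Clause λ C → Σ Lit λ l → C ∈ χ × l ∈ C × isExistential Π l ≡ true
                 × QRAT Π (χ ∖[ C ]) C l

ΠC : ℕ → Prefix
ΠC n = (∃q , concatMap (λ i → x (4 * i + 1) ∷ x (4 * i + 2) ∷ []) (upTo n))
     ∷ (∀q , map (λ i → u (2 * i + 1)) (upTo n))
     ∷ (∃q , map (λ i → x (4 * i + 3)) (upTo n))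
     ∷ (∀q , map (λ i → u (2 * i + 2)) (upTo n))
     ∷ (∃q , map (λ i → x (4 * i + 4)) (upTo n))
     ∷ []

clausesC : ℕ → CNF
clausesC i =
    (pos x1 ∷ pos u1 ∷ neg x3 ∷ [])
  ∷ (pos x2 ∷ neg u1 ∷ pos x3 ∷ [])
  ∷ (neg x1 ∷ neg u1 ∷ neg x3 ∷ [])
  ∷ (neg x2 ∷ pos u1 ∷ pos x3 ∷ [])
  ∷ (pos u1 ∷ neg x3 ∷ pos x4 ∷ [])
  ∷ (neg u2 ∷ neg x4 ∷ [])
  ∷ (neg x1 ∷ pos u2 ∷ neg x4 ∷ [])
  ∷ []
  where
  x1 = x (4 * i + 1)
  x2 = x (4 * i + 2)
  x3 = x (4 * i + 3)
  x4 = x (4 * i + 4)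
  u1 = u (2 * i + 1)
  u2 = u (2 * i + 2)

ψC : ℕ → CNF
ψC n = concatMap clausesC (upTo n)

module Submission where

-- The clauses of ψ_C(n) fall into n blocks on pairwise disjoint variables, each
-- a copy of one block in the roles x₁ … x₄, u₁, u₂; facts about block j are
-- computed on this abstract block and transported along the injective
-- renaming of the roles into block j.
--
-- (a) A block is eliminated in the order C₀ (on x₁), C₂, C₁ (on x₃), C₃, C₄,
-- C₅, C₆.  Only the first and third steps have resolution partners, and their
-- outer resolvents are u₁ ∨ ¬x₃ and the tautology x₂ ∨ ¬u₁ ∨ u₁.  For u₁ ∨ ¬x₃,
-- QUP in Abs(Π,3) propagates ¬u₁, x₃, then x₄ by C₄, and C₅ reduces to the
-- universal ¬u₂.  Semantically, a model falsifying u₁ ∨ ¬x₃ on a path also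
-- contains, below the universal node u₂ of that path, a path with u₂ true,
-- and that path violates C₄ or C₅.  All other steps are vacuous.
--
-- (b) For every clause C and existential l ∈ C there are a partner D ∋ ¬l and
-- a valuation, false outside the block, satisfying every clause but C and
-- falsifying the outer resolvent of C and D.  Unit propagation is sound for
-- total valuations, so that resolvent is not AT.

open import Defs
import Data.Bool as Bool
open import Data.Bool using (Bool; true; false; not; _∧_; _∨_; T; if_then_else_)
open import Data.Bool.ListAction using (or; any; all)
open import Data.Bool.Properties using (T-≡; T-not-≡; not-involutive; ∧-conicalˡ; ∧-conicalʳ)
open import Data.Empty using (⊥; ⊥-elim)
open import Data.List using (List; []; _∷_; _++_; [_]; map; filter; filterᵇ; concatMap; upTo; length;
                             cartesianProductWith; drop; foldr)
open import Data.List.Membership.DecPropositional using () renaming (_∈?_ to ∈?)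
open import Data.List.Membership.Propositional using (_∈_; _∉_; find; lose)
import Data.List.Membership.Propositional.Properties as ∈
import Data.List.Properties as List
open import Data.List.Properties using (map-id; map-∘; map-cong; map-++; filter-++; filter-all)
open import Data.List.Relation.Binary.Subset.Propositional using (_⊆_)
open import Data.List.Relation.Unary.All using (All; []; _∷_)
import Data.List.Relation.Unary.All as All
import Data.List.Relation.Unary.All.Properties as All
open import Data.List.Relation.Unary.AllPairs using ([]; _∷_)
open import Data.List.Relation.Unary.Any using (Any; here; there)
import Data.List.Relation.Unary.Any as Any
import Data.List.Relation.Unary.Any.Properties as Any
open import Data.List.Relation.Unary.Unique.Propositional using (Unique)
import Data.List.Relation.Unary.Unique.Propositional.Properties as Unique
open import Data.Nat using (ℕ; zero; suc; _+_; _*_; _≤_; _<_; _≤ᵇ_; _<ᵇ_; _≡ᵇ_; pred; _⊔_; z≤n; s≤s)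
import Data.Nat.Properties as ℕ
open import Data.Product using (∃; ∃-syntax; _×_; _,_; proj₁; proj₂; map₁)
import Data.Product.Properties as ×
open import Data.Product.Properties using (,-injective)
open import Data.Sum using (_⊎_; inj₁; inj₂; [_,_]′)
open import Data.Unit using (⊤; tt)
open import Function using (_∘_; _$_; id; Equivalence; case_of_; mk⇔)
open import Relation.Binary.Construct.Closure.ReflexiveTransitive using (ε; _◅_; _◅◅_)
open import Relation.Binary.Definitions using (DecidableEquality; tri<; tri≈; tri>)
open import Relation.Binary.PropositionalEquality
  using (_≡_; _≢_; refl; sym; trans; cong; cong₂; subst; subst₂)
open import Relation.Nullary using (¬_; yes; no; does; ¬?)
open import Relation.Nullary.Decidable
  using (⌊_⌋; T?; map′; toWitnessFalse; does-⇔; dec-true; dec-false; isYes≗does)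
open import Relation.Unary using (Decidable)

private
  variable
    A : Set

pattern #₀ = here refl
pattern #₁ = there #₀
pattern #₂ = there #₁
pattern #₃ = there #₂
pattern #₄ = there #₃
pattern #₅ = there #₄
pattern #₆ = there #₅

any-≟≡does-∈? : (_≟_ : DecidableEquality A) (a : A) (xs : List A) →
                any (λ b → ⌊ a ≟ b ⌋) xs ≡ does (∈? _≟_ a xs)
any-≟≡does-∈? _≟_ a [] = refl
any-≟≡does-∈? _≟_ a (b ∷ xs) = cong₂ _∨_ (isYes≗does (a ≟ b)) (any-≟≡does-∈? _≟_ a xs)

∈⇒any-≟ : (_≟_ : DecidableEquality A) {a : A} {xs : List A} →
          a ∈ xs → any (λ b → ⌊ a ≟ b ⌋) xs ≡ true
∈⇒any-≟ _≟_ {a} {xs} a∈ = trans (any-≟≡does-∈? _≟_ a xs) (dec-true (∈? _≟_ a xs) a∈)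

∉⇒any-≟ : (_≟_ : DecidableEquality A) {a : A} {xs : List A} →
          a ∉ xs → any (λ b → ⌊ a ≟ b ⌋) xs ≡ false
∉⇒any-≟ _≟_ {a} {xs} a∉ = trans (any-≟≡does-∈? _≟_ a xs) (dec-false (∈? _≟_ a xs) a∉)

any-≟⇒∈ : (_≟_ : DecidableEquality A) {a : A} {xs : List A} →
          any (λ b → ⌊ a ≟ b ⌋) xs ≡ true → a ∈ xs
any-≟⇒∈ _≟_ {a} {xs} e with ∈? _≟_ a xs | any-≟≡does-∈? _≟_ a xs
... | yes a∈xs | _ = a∈xs
... | no _ | e′ with () ← trans (sym e) e′

satisfies-∈ : ∀ {σ C k} → k ∈ C → k ∈ σ → satisfies σ C ≡ true
satisfies-∈ k∈C k∈σ =
  Equivalence.to T-≡ (Any.any⁺ _ (lose k∈C (Equivalence.from T-≡ (∈⇒any-≟ _≟L_ k∈σ))))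

satisfies-∃ : ∀ {σ} C → satisfies σ C ≡ true → ∃[ k ] k ∈ C × k ∈ σ
satisfies-∃ C e with find (Any.any⁻ _ C (Equivalence.from T-≡ e))
... | k , k∈C , k∈σ = k , k∈C , any-≟⇒∈ _≟L_ (Equivalence.to T-≡ k∈σ)

∈-dropFalsified : ∀ {σ C k} → k ∈ C → ~ k ∉ σ → k ∈ dropFalsified σ C
∈-dropFalsified k∈C ~k∉σ =
  ∈.∈-filter⁺ _ k∈C (Equivalence.from T-not-≡ (∉⇒any-≟ _≟L_ ~k∉σ))

value : (Var → Bool) → Lit → Bool
value τ (pos v) = τ v
value τ (neg v) = not (τ v)

value-~ : ∀ τ k → value τ (~ k) ≡ not (value τ k)
value-~ τ (pos v) = refl
value-~ τ (neg v) = sym (not-involutive (τ v))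

_⊨_ : (Var → Bool) → Clause → Set
τ ⊨ C = Any (λ k → value τ k ≡ true) C

⊨-dropFalsified : ∀ {τ σ C} → All (λ k → value τ k ≡ true) σ → τ ⊨ C → τ ⊨ dropFalsified σ C
⊨-dropFalsified {τ} hσ τ⊨C with find τ⊨C
... | k , k∈C , k-true = lose (∈-dropFalsified k∈C ~k∉σ) k-true
  where
  ~k∉σ : ~ k ∉ _
  ~k∉σ ~k∈σ with () ← trans (sym (All.lookup hσ ~k∈σ)) (trans (value-~ τ k) (cong not k-true))

UP-sound : ∀ τ {χ σ} → All (τ ⊨_) χ → All (λ k → value τ k ≡ true) σ → ¬ Derives⊥ (λ C → C) χ σ
UP-sound τ hχ hσ (conflict C∈χ _ drop≡[])
  with () ← subst (τ ⊨_) drop≡[] (⊨-dropFalsified hσ (All.lookup hχ C∈χ))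
UP-sound τ hχ hσ (unit C∈χ _ drop≡[k] d)
  with subst (τ ⊨_) drop≡[k] (⊨-dropFalsified hσ (All.lookup hχ C∈χ))
... | here k-true = UP-sound τ hχ (k-true ∷ hσ) d

¬AT-of-countermodel : ∀ τ {E χ} → All (τ ⊨_) χ → All (λ k → value τ k ≡ false) E → ¬ AT E χ
¬AT-of-countermodel τ hχ hE = UP-sound τ (All.++⁺ hχ (All.map⁺ (All.map falsified hE))) []
  where
  falsified : ∀ {k} → value τ k ≡ false → τ ⊨ [ ~ k ]
  falsified {k} k-false = here (trans (value-~ τ k) (cong not k-false))

vars : List (Quant × Var) → List Var
vars = map proj₂

Assigned : Var → List Lit → Set
Assigned v σ = ∃[ b ] lit v b ∈ σ

Consistent : List Lit → Set
Consistent σ = ∀ {v} → pos v ∈ σ → neg v ∈ σ → ⊥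

lit-injective : ∀ {v w b c} → lit v b ≡ lit w c → v ≡ w × b ≡ c
lit-injective {b = true} {true} refl = refl , refl
lit-injective {b = false} {false} refl = refl , refl

lit-pos-neg : ∀ {v b w w′} → lit v b ≡ pos w → lit v b ≡ neg w′ → ⊥
lit-pos-neg {b = true} refl ()
lit-pos-neg {b = false} () _

lit-var : ∀ k b → lit (var k) b ≡ k ⊎ lit (var k) b ≡ ~ k
lit-var (pos v) true = inj₁ refl
lit-var (pos v) false = inj₂ refl
lit-var (neg v) true = inj₂ refl
lit-var (neg v) false = inj₁ refl

module _ {P Q : List Lit → Set} where

  AllPaths-map : (∀ {σ} → P σ → Q σ) → ∀ {qs σ} (t : PreModel qs) → AllPaths P σ t → AllPaths Q σ t
  AllPaths-map f leaf p = f p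
  AllPaths-map f (∀node t₀ t₁) (p₀ , p₁) = AllPaths-map f t₀ p₀ , AllPaths-map f t₁ p₁
  AllPaths-map f (∃node b t) p = AllPaths-map f t p

  AllPaths-zip : ∀ {qs σ} (t : PreModel qs) → AllPaths P σ t → AllPaths Q σ t →
                 AllPaths (λ σ → P σ × Q σ) σ t
  AllPaths-zip leaf p q = p , q
  AllPaths-zip (∀node t₀ t₁) (p₀ , p₁) (q₀ , q₁) = AllPaths-zip t₀ p₀ q₀ , AllPaths-zip t₁ p₁ q₁
  AllPaths-zip (∃node b t) p q = AllPaths-zip t p q

AllPaths-some : ∀ {P : List Lit → Set} {qs σ} (t : PreModel qs) → AllPaths P σ t → ∃ P
AllPaths-some leaf p = _ , p
AllPaths-some (∀node t₀ t₁) (p₀ , p₁) = AllPaths-some t₀ p₀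
AllPaths-some (∃node b t) p = AllPaths-some t p

AllPaths-invariant : (I : List Lit → List (Quant × Var) → Set) →
                     (∀ {σ q v qs} b → I σ ((q , v) ∷ qs) → I (lit v b ∷ σ) qs) →
                     ∀ {qs σ} (t : PreModel qs) → I σ qs → AllPaths (λ σ → I σ []) σ t
AllPaths-invariant I preserved leaf i = i
AllPaths-invariant I preserved (∀node t₀ t₁) i =
  AllPaths-invariant I preserved t₀ (preserved false i) , AllPaths-invariant I preserved t₁ (preserved true i)
AllPaths-invariant I preserved (∃node b t) i = AllPaths-invariant I preserved t (preserved b i)

AllPaths-⊇ : ∀ {qs σ} (t : PreModel qs) → AllPaths (σ ⊆_) σ t
AllPaths-⊇ {σ = σ} t = AllPaths-invariant (λ σ′ _ → σ ⊆ σ′) (λ b σ⊆σ′ → there ∘ σ⊆σ′) t id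

AllPaths-satisfies : ∀ {qs σ E} (t : PreModel qs) → satisfies σ E ≡ true →
                     AllPaths (λ σ′ → satisfies σ′ E ≡ true) σ t
AllPaths-satisfies {E = E} t σ⊨E with satisfies-∃ E σ⊨E
... | k , k∈E , k∈σ = AllPaths-map (λ σ⊆σ′ → satisfies-∈ k∈E (σ⊆σ′ k∈σ)) t (AllPaths-⊇ t)

assign-step : ∀ {v w ws σ} b → v ∈ w ∷ ws ⊎ Assigned v σ → v ∈ ws ⊎ Assigned v (lit w b ∷ σ)
assign-step b (inj₁ (here refl)) = inj₂ (b , here refl)
assign-step b (inj₁ (there v∈ws)) = inj₁ v∈ws
assign-step b (inj₂ (c , v∈σ)) = inj₂ (c , there v∈σ)

AllPaths-assigned : ∀ {v qs σ} (t : PreModel qs) → v ∈ vars qs ⊎ Assigned v σ → AllPaths (Assigned v) σ t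
AllPaths-assigned {v} t h =
  AllPaths-map [ (λ ()) , id ]′ t
    (AllPaths-invariant (λ σ qs → v ∈ vars qs ⊎ Assigned v σ) assign-step t h)

AllPaths-consistent : ∀ {qs} (t : PreModel qs) → Unique (vars qs) → AllPaths Consistent [] t
AllPaths-consistent t uq =
  AllPaths-map {P = λ σ → Invariant σ []} proj₁ t
    (AllPaths-invariant Invariant (λ {σ} {q} {v} {qs} → descend {σ} {q} {v} {qs}) t
                        ((λ ()) , uq , All.tabulate λ _ → λ { (_ , ()) }))
  where
  Invariant : List Lit → List (Quant × Var) → Set
  Invariant σ qs = Consistent σ × Unique (vars qs) × All (λ w → ¬ Assigned w σ) (vars qs)

  descend : ∀ {σ q v qs} b → Invariant σ ((q , v) ∷ qs) → Invariant (lit v b ∷ σ) qs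
  descend {σ} {v = v} b (cons , v∉qs ∷ uq , v-free ∷ qs-free) =
    cons′ , uq , All.zipWith still-free (v∉qs , qs-free)
    where
    cons′ : Consistent (lit v b ∷ σ)
    cons′ (here e) (here e′) = lit-pos-neg (sym e) (sym e′)
    cons′ (here e) (there w∈σ) = v-free (false , subst (λ w → neg w ∈ σ) (proj₁ (lit-injective e)) w∈σ)
    cons′ (there w∈σ) (here e) = v-free (true , subst (λ w → pos w ∈ σ) (proj₁ (lit-injective e)) w∈σ)
    cons′ (there p) (there n) = cons p n

    still-free : ∀ {w} → v ≢ w × ¬ Assigned w σ → ¬ Assigned w (lit v b ∷ σ)
    still-free (v≢w , _) (c , here e) = v≢w (sym (proj₁ (lit-injective e)))
    still-free (_ , w-free) (c , there w∈σ) = w-free (c , w∈σ)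

-- Once the variables of E are decided, a model either satisfies E on all
-- extensions or falsifies it; in the latter case the branch v = true below
-- the node of the universal v contains a path refuting P.
universal-reduction :
  ∀ {P : List Lit → Set} {E v qs} A B → qs ≡ A ++ (∀q , v) ∷ B →
  All (λ k → var k ∈ vars A) E →
  (∀ {σ} → P σ → All (λ k → ~ k ∈ σ) E → pos v ∈ σ → ⊥) →
  (t : PreModel qs) → AllPaths P [] t → AllPaths (λ σ → satisfies σ E ≡ true) [] t
universal-reduction {P} {E} {v} A B refl E-before refuted t = go A (All.map inj₁ E-before) t
  where
  go : ∀ A {σ} → All (λ k → var k ∈ vars A ⊎ Assigned (var k) σ) E →
       (t : PreModel (A ++ (∀q , v) ∷ B)) → AllPaths P σ t → AllPaths (λ σ → satisfies σ E ≡ true) σ t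
  go [] {σ} decided (∀node t₀ t₁) (_ , p₁) with satisfies σ E in σ⊨E
  ... | true = AllPaths-satisfies {E = E} (∀node t₀ t₁) σ⊨E
  ... | false with AllPaths-some t₁ (AllPaths-zip t₁ p₁ (AllPaths-⊇ t₁))
  ...   | σ′ , Pσ′ , σ⊆σ′ = ⊥-elim (refuted Pσ′ (All.tabulate (σ⊆σ′ ∘ there ∘ falsified)) (σ⊆σ′ (here refl)))
    where
    falsified : ∀ {k} → k ∈ E → ~ k ∈ σ
    falsified {k} k∈E with All.lookup decided k∈E
    ... | inj₂ (b , kb∈σ) with lit-var k b
    ...   | inj₂ kb≡~k = subst (_∈ σ) kb≡~k kb∈σ
    ...   | inj₁ kb≡k with () ← trans (sym (satisfies-∈ k∈E (subst (_∈ σ) kb≡k kb∈σ))) σ⊨E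
  go ((q , w) ∷ A) decided (∀node t₀ t₁) (p₀ , p₁) =
    go A (All.map (assign-step false) decided) t₀ p₀ , go A (All.map (assign-step true) decided) t₁ p₁
  go ((q , w) ∷ A) decided (∃node b t) p = go A (All.map (assign-step b) decided) t p

vars-tag : ∀ q vs → vars (map (q ,_) vs) ≡ vs
vars-tag q vs = trans (sym (map-∘ vs)) (map-id vs)

vars-qvars-∷ : ∀ q vs Π → vars (qvars ((q , vs) ∷ Π)) ≡ vs ++ vars (qvars Π)
vars-qvars-∷ q vs Π = trans (map-++ proj₂ (map (q ,_) vs) (qvars Π)) (cong (_++ _) (vars-tag q vs))

quantOf-here : ∀ {q vs Π v} → v ∈ vs → quantOf ((q , vs) ∷ Π) v ≡ q
quantOf-here {vs = w ∷ vs} {v = v} v∈ with v ≟V w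
... | yes _ = refl
quantOf-here {vs = w ∷ vs} (here v≡w) | no v≢w = ⊥-elim (v≢w v≡w)
quantOf-here {q} {w ∷ vs} {Π} (there v∈vs) | no _ = quantOf-here {q} {vs} {Π} v∈vs

quantOf-there : ∀ {q vs Π v} → v ∉ vs → quantOf ((q , vs) ∷ Π) v ≡ quantOf Π v
quantOf-there {vs = []} v∉ = refl
quantOf-there {vs = w ∷ vs} {Π} {v} v∉ with v ≟V w
... | yes v≡w = ⊥-elim (v∉ (here v≡w))
... | no _ = quantOf-there {vs = vs} {Π} (v∉ ∘ there)

position-∈ : ∀ A B {v} → v ∈ vars A → position (A ++ B) v < length A
position-∈ ((q , w) ∷ A) B {v} v∈ with v ≟V w
... | yes _ = s≤s z≤n
position-∈ ((q , w) ∷ A) B (here v≡w) | no v≢w = ⊥-elim (v≢w v≡w)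
position-∈ ((q , w) ∷ A) B (there v∈A) | no _ = s≤s (position-∈ A B v∈A)

position-∉ : ∀ A B {v} → v ∉ vars A → position (A ++ B) v ≡ length A + position B v
position-∉ [] B v∉ = refl
position-∉ ((q , w) ∷ A) B {v} v∉ with v ≟V w
... | yes v≡w = ⊥-elim (v∉ (here v≡w))
... | no _ = cong suc (position-∉ A B (v∉ ∘ there))

position-self : ∀ A {q v} B → position (A ++ (q , v) ∷ B) v ≤ length A
position-self A {q} {v} B with ∈? _≟V_ v (vars A)
... | yes v∈A = ℕ.<⇒≤ (position-∈ A _ v∈A)
... | no v∉A rewrite position-∉ A ((q , v) ∷ B) v∉A with v ≟V v
...   | yes _ = ℕ.≤-reflexive (ℕ.+-identityʳ (length A))
...   | no v≢v = ⊥-elim (v≢v refl)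

position<⇒∈ : ∀ A {q v} B {w} → position (A ++ (q , v) ∷ B) w < position (A ++ (q , v) ∷ B) v → w ∈ vars A
position<⇒∈ A {q} {v} B {w} w<v with ∈? _≟V_ w (vars A)
... | yes w∈A = w∈A
... | no w∉A = ⊥-elim (ℕ.<⇒≱ (ℕ.<-≤-trans w<v (position-self A B))
                            (subst (length A ≤_) (sym (position-∉ A _ w∉A)) (ℕ.m≤m+n _ _)))

∈-qvars : ∀ {Π q vs v} → (q , vs) ∈ Π → v ∈ vs → (q , v) ∈ qvars Π
∈-qvars (here refl) v∈vs = ∈.∈-++⁺ˡ (∈.∈-map⁺ _ v∈vs)
∈-qvars {(q , vs) ∷ Π} (there b∈Π) v∈vs = ∈.∈-++⁺ʳ (map (q ,_) vs) (∈-qvars b∈Π v∈vs)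

∈-vars : ∀ {qs q v} → (q , v) ∈ qs → v ∈ vars qs
∈-vars = ∈.∈-map⁺ proj₂

module _ (grade : Var → ℕ) where

  GradedBlock : ℕ → List Var → Set
  GradedBlock k vs = Unique vs × All (λ v → grade v ≡ k) vs

  Graded : ℕ → Prefix → Set
  Graded k [] = ⊤
  Graded k ((q , vs) ∷ Π) = GradedBlock k vs × Graded (suc k) Π

  graded-≥ : ∀ {k Π v} → Graded k Π → v ∈ vars (qvars Π) → k ≤ grade v
  graded-≥ {Π = (q , vs) ∷ Π} ((_ , vs-k) , gΠ) v∈
    with ∈.∈-++⁻ vs (subst (_ ∈_) (vars-qvars-∷ q vs Π) v∈)
  ... | inj₁ v∈vs = ℕ.≤-reflexive (sym (All.lookup vs-k v∈vs))
  ... | inj₂ v∈Π = ℕ.<⇒≤ (graded-≥ gΠ v∈Π)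

  graded-∉ : ∀ {k vs v} → All (λ w → grade w ≡ k) vs → k < grade v → v ∉ vs
  graded-∉ vs-k k<v v∈vs = ℕ.<-irrefl (sym (All.lookup vs-k v∈vs)) k<v

  graded-unique : ∀ {k Π} → Graded k Π → Unique (vars (qvars Π))
  graded-unique {Π = []} _ = []
  graded-unique {Π = (q , vs) ∷ Π} ((uq , vs-k) , gΠ) =
    subst Unique (sym (vars-qvars-∷ q vs Π))
      (Unique.++⁺ uq (graded-unique gΠ) λ (v∈vs , v∈Π) → graded-∉ vs-k (graded-≥ gΠ v∈Π) v∈vs)

  graded-quantOf : ∀ {k Π q vs v} → Graded k Π → (q , vs) ∈ Π → v ∈ vs → quantOf Π v ≡ q
  graded-quantOf {Π = _ ∷ Π} _ (here refl) v∈vs = quantOf-here {Π = Π} v∈vs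
  graded-quantOf {Π = (q′ , vs′) ∷ Π} ((_ , vs′-k) , gΠ) (there b∈Π) v∈vs =
    trans (quantOf-there {Π = Π} (graded-∉ vs′-k (graded-≥ gΠ (∈-vars (∈-qvars b∈Π v∈vs)))))
          (graded-quantOf gΠ b∈Π v∈vs)

  graded-position : ∀ {k Π v w} → Graded k Π → v ∈ vars (qvars Π) → grade v < grade w →
                    position (qvars Π) v < position (qvars Π) w
  graded-position {k} {(q , vs) ∷ Π} {v} {w} ((_ , vs-k) , gΠ) v∈ v<w
    with ∈.∈-++⁻ vs (subst (_ ∈_) (vars-qvars-∷ q vs Π) v∈)
  ... | inj₁ v∈vs =
    ℕ.<-≤-trans (position-∈ B _ (subst (v ∈_) (sym (vars-tag q vs)) v∈vs))
                (subst (length B ≤_) (sym (position-∉ B _ (∉B (ℕ.≤-<-trans k≤v v<w)))) (ℕ.m≤m+n _ _))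
    where
    B = map (q ,_) vs
    ∉B : ∀ {u} → k < grade u → u ∉ vars B
    ∉B k<u = graded-∉ vs-k k<u ∘ subst (_ ∈_) (vars-tag q vs)
    k≤v = ℕ.≤-reflexive (sym (All.lookup vs-k v∈vs))
  ... | inj₂ v∈Π =
    subst₂ _<_ (sym (position-∉ B _ (∉B k<v))) (sym (position-∉ B _ (∉B (ℕ.<-trans k<v v<w))))
      (ℕ.+-monoʳ-< (length B) (graded-position gΠ v∈Π v<w))
    where
    B = map (q ,_) vs
    ∉B : ∀ {u} → k < grade u → u ∉ vars B
    ∉B k<u = graded-∉ vs-k k<u ∘ subst (_ ∈_) (vars-tag q vs)
    k<v = graded-≥ gΠ v∈Π

  graded-Abs : ∀ {k} Π i → Graded k Π → Graded k (Abs Π i)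
  graded-Abs Π zero gΠ = gΠ
  graded-Abs [] (suc i) _ = tt
  graded-Abs (b ∷ Π) (suc i) (gb , gΠ) = gb , graded-Abs Π i gΠ

  universal-reduction-graded :
    ∀ {k Π} {P : List Lit → Set} {E v} → Graded k Π → (∀q , v) ∈ qvars Π →
    All (λ l → var l ∈ vars (qvars Π) × grade (var l) < grade v) E →
    (∀ {σ} → P σ → All (λ l → ~ l ∈ σ) E → pos v ∈ σ → ⊥) →
    (t : PreModel (qvars Π)) → AllPaths P [] t → AllPaths (λ σ → satisfies σ E ≡ true) [] t
  universal-reduction-graded {Π = Π} {v = v} gΠ v∈ E-below refuted with ∈.∈-∃++ v∈
  ... | A , B , split = universal-reduction A B split (All.map precedes E-below) refuted
    where
    precedes : ∀ {w} → w ∈ vars (qvars Π) × grade w < grade v → w ∈ vars A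
    precedes (w∈ , w<v) =
      position<⇒∈ A B (subst (λ qs → position qs _ < position qs v) split (graded-position gΠ w∈ w<v))

data Role : Set where
  x₁ x₂ x₃ x₄ u₁ u₂ : Role

blockVar : ℕ → Role → Var
blockVar i x₁ = x (4 * i + 1)
blockVar i x₂ = x (4 * i + 2)
blockVar i x₃ = x (4 * i + 3)
blockVar i x₄ = x (4 * i + 4)
blockVar i u₁ = u (2 * i + 1)
blockVar i u₂ = u (2 * i + 2)

-- decodeX m and decodeU m are the block and role of x_{m+1} and u_{m+1}
decodeX : ℕ → ℕ × Role
decodeX 0 = 0 , x₁
decodeX 1 = 0 , x₂
decodeX 2 = 0 , x₃
decodeX 3 = 0 , x₄
decodeX (suc (suc (suc (suc m)))) = map₁ suc (decodeX m)

decodeU : ℕ → ℕ × Role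
decodeU 0 = 0 , u₁
decodeU 1 = 0 , u₂
decodeU (suc (suc m)) = map₁ suc (decodeU m)

decode : Var → ℕ × Role
decode (x m) = decodeX (pred m)
decode (u m) = decodeU (pred m)

decodeX-+ : ∀ i m → decodeX (4 * i + m) ≡ map₁ (i +_) (decodeX m)
decodeX-+ zero m = refl
decodeX-+ (suc i) m = trans (cong (λ k → decodeX (k + m)) (ℕ.*-suc 4 i)) (cong (map₁ suc) (decodeX-+ i m))

decodeU-+ : ∀ i m → decodeU (2 * i + m) ≡ map₁ (i +_) (decodeU m)
decodeU-+ zero m = refl
decodeU-+ (suc i) m = trans (cong (λ k → decodeU (k + m)) (ℕ.*-suc 2 i)) (cong (map₁ suc) (decodeU-+ i m))

decode-x : ∀ i a → decode (x (4 * i + suc a)) ≡ map₁ (i +_) (decodeX a)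
decode-x i a = trans (cong (decodeX ∘ pred) (ℕ.+-suc (4 * i) a)) (decodeX-+ i a)

decode-u : ∀ i a → decode (u (2 * i + suc a)) ≡ map₁ (i +_) (decodeU a)
decode-u i a = trans (cong (decodeU ∘ pred) (ℕ.+-suc (2 * i) a)) (decodeU-+ i a)

decode-blockVar : ∀ i r → decode (blockVar i r) ≡ (i , r)
decode-blockVar i x₁ = trans (decode-x i 0) (cong (_, x₁) (ℕ.+-identityʳ i))
decode-blockVar i x₂ = trans (decode-x i 1) (cong (_, x₂) (ℕ.+-identityʳ i))
decode-blockVar i x₃ = trans (decode-x i 2) (cong (_, x₃) (ℕ.+-identityʳ i))
decode-blockVar i x₄ = trans (decode-x i 3) (cong (_, x₄) (ℕ.+-identityʳ i))
decode-blockVar i u₁ = trans (decode-u i 0) (cong (_, u₁) (ℕ.+-identityʳ i))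
decode-blockVar i u₂ = trans (decode-u i 1) (cong (_, u₂) (ℕ.+-identityʳ i))

blockVar-injective : ∀ {i j r r′} → blockVar i r ≡ blockVar j r′ → i ≡ j × r ≡ r′
blockVar-injective {i} {j} {r} {r′} e =
  ,-injective (trans (sym (decode-blockVar i r)) (trans (cong decode e) (decode-blockVar j r′)))

_≟R_ : DecidableEquality Role
r ≟R r′ = map′ (proj₂ ∘ blockVar-injective) (cong (blockVar 0)) (blockVar 0 r ≟V blockVar 0 r′)

level : Role → ℕ
level x₁ = 1
level x₂ = 1
level u₁ = 2
level x₃ = 3
level u₂ = 4
level x₄ = 5

quantifier : Role → Quant
quantifier u₁ = ∀q
quantifier u₂ = ∀q
quantifier _ = ∃q

grade : Var → ℕ
grade = level ∘ proj₂ ∘ decode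

grade-blockVar : ∀ i r → grade (blockVar i r) ≡ level r
grade-blockVar i r = cong (level ∘ proj₂) (decode-blockVar i r)

roleBlock : Role → ℕ → List Var
roleBlock r n = map (λ i → blockVar i r) (upTo n)

roleBlock-graded : ∀ n r → GradedBlock grade (level r) (roleBlock r n)
roleBlock-graded n r = Unique.map⁺ (proj₁ ∘ blockVar-injective) (Unique.upTo⁺ n) ,
                       All.map⁺ (All.tabulate λ {i} _ → grade-blockVar i r)

prefixBlock : Role → ℕ → List Var
prefixBlock x₁ n = cartesianProductWith blockVar (upTo n) (x₁ ∷ x₂ ∷ [])
prefixBlock x₂ n = prefixBlock x₁ n
prefixBlock r n = roleBlock r n

ΠC-by-roles : ℕ → Prefix
ΠC-by-roles n = (∃q , prefixBlock x₁ n) ∷ (∀q , prefixBlock u₁ n) ∷ (∃q , prefixBlock x₃ n)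
              ∷ (∀q , prefixBlock u₂ n) ∷ (∃q , prefixBlock x₄ n) ∷ []

ΠC-blocks : ∀ n → ΠC n ≡ ΠC-by-roles n
ΠC-blocks n = cong (λ B → (∃q , B) ∷ drop 1 (ΠC n)) (first-block (upTo n))
  where
  first-block : ∀ is → concatMap (λ i → x (4 * i + 1) ∷ x (4 * i + 2) ∷ []) is
                     ≡ cartesianProductWith blockVar is (x₁ ∷ x₂ ∷ [])
  first-block [] = refl
  first-block (i ∷ is) = cong (λ vs → x (4 * i + 1) ∷ x (4 * i + 2) ∷ vs) (first-block is)

∈-prefixBlock : ∀ {n j} → j < n → ∀ r → blockVar j r ∈ prefixBlock r n
∈-prefixBlock j<n x₁ = ∈.∈-cartesianProductWith⁺ blockVar (∈.∈-upTo⁺ j<n) #₀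
∈-prefixBlock j<n x₂ = ∈.∈-cartesianProductWith⁺ blockVar (∈.∈-upTo⁺ j<n) #₁
∈-prefixBlock j<n x₃ = ∈.∈-map⁺ _ (∈.∈-upTo⁺ j<n)
∈-prefixBlock j<n x₄ = ∈.∈-map⁺ _ (∈.∈-upTo⁺ j<n)
∈-prefixBlock j<n u₁ = ∈.∈-map⁺ _ (∈.∈-upTo⁺ j<n)
∈-prefixBlock j<n u₂ = ∈.∈-map⁺ _ (∈.∈-upTo⁺ j<n)

prefixBlock-graded : ∀ n r → GradedBlock grade (level r) (prefixBlock r n)
prefixBlock-graded n x₁ =
  Unique.cartesianProductWith⁺ blockVar blockVar-injective (Unique.upTo⁺ n) (((λ ()) ∷ []) ∷ [] ∷ []) ,
  All.tabulate λ v∈ → case ∈.∈-cartesianProductWith⁻ blockVar (upTo n) (x₁ ∷ x₂ ∷ []) v∈ of λ where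
    (i , .x₁ , _ , #₀ , refl) → grade-blockVar i x₁
    (i , .x₂ , _ , #₁ , refl) → grade-blockVar i x₂
prefixBlock-graded n x₂ = prefixBlock-graded n x₁
prefixBlock-graded n x₃ = roleBlock-graded n x₃
prefixBlock-graded n x₄ = roleBlock-graded n x₄
prefixBlock-graded n u₁ = roleBlock-graded n u₁
prefixBlock-graded n u₂ = roleBlock-graded n u₂

ΠC-graded : ∀ n → Graded grade 1 (ΠC n)
ΠC-graded n = subst (Graded grade 1) (sym (ΠC-blocks n))
  (prefixBlock-graded n x₁ , prefixBlock-graded n u₁ , prefixBlock-graded n x₃ ,
   prefixBlock-graded n u₂ , prefixBlock-graded n x₄ , tt)

block∈ΠC : ∀ n r → (quantifier r , prefixBlock r n) ∈ ΠC n
block∈ΠC n r = subst ((quantifier r , prefixBlock r n) ∈_) (sym (ΠC-blocks n)) (block∈ r)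
  where
  block∈ : ∀ r → (quantifier r , prefixBlock r n) ∈ ΠC-by-roles n
  block∈ x₁ = #₀
  block∈ x₂ = #₀
  block∈ u₁ = #₁
  block∈ x₃ = #₂
  block∈ u₂ = #₃
  block∈ x₄ = #₄

blockVar∈ΠC : ∀ {n j} → j < n → ∀ r → blockVar j r ∈ vars (qvars (ΠC n))
blockVar∈ΠC {n} j<n r = ∈-vars (∈-qvars (block∈ΠC n r) (∈-prefixBlock j<n r))

quantOf-ΠC : ∀ {n j} → j < n → ∀ r → quantOf (ΠC n) (blockVar j r) ≡ quantifier r
quantOf-ΠC {n} j<n r = graded-quantOf grade (ΠC-graded n) (block∈ΠC n r) (∈-prefixBlock j<n r)

position-ΠC : ∀ {n j k r r′} → j < n → level r < level r′ →
              position (qvars (ΠC n)) (blockVar j r) < position (qvars (ΠC n)) (blockVar k r′)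
position-ΠC {n} {j} {k} {r} {r′} j<n r<r′ =
  graded-position grade (ΠC-graded n) (blockVar∈ΠC j<n r)
    (subst₂ _<_ (sym (grade-blockVar j r)) (sym (grade-blockVar k r′)) r<r′)

∉-prefixBlock : ∀ {n j r r′} → T (level r′ <ᵇ level r) → blockVar j r ∉ prefixBlock r′ n
∉-prefixBlock {n} {j} {r} {r′} r′<r =
  graded-∉ grade (proj₂ (prefixBlock-graded n r′))
    (subst (level r′ <_) (sym (grade-blockVar j r)) (ℕ.<ᵇ⇒< (level r′) (level r) r′<r))

blockOf-ΠC : ∀ {n j} → j < n → ∀ r → blockOf (ΠC n) (blockVar j r) ≡ level r
blockOf-ΠC {n} {j} j<n r = trans (cong (λ Π → blockOf Π (blockVar j r)) (ΠC-blocks n)) (by-role r)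
  where
  inside : ∀ r → any (λ w → ⌊ blockVar j r ≟V w ⌋) (prefixBlock r n) ≡ true
  inside r = ∈⇒any-≟ _≟V_ (∈-prefixBlock j<n r)
  before : ∀ r′ {r} → T (level r′ <ᵇ level r) → any (λ w → ⌊ blockVar j r ≟V w ⌋) (prefixBlock r′ n) ≡ false
  before r′ {r} r′<r = ∉⇒any-≟ _≟V_ (∉-prefixBlock {n} {j} {r} {r′} r′<r)
  by-role : ∀ r → blockOf (ΠC-by-roles n) (blockVar j r) ≡ level r
  by-role x₁ rewrite inside x₁ = refl
  by-role x₂ rewrite inside x₂ = refl
  by-role u₁ rewrite before x₁ {u₁} tt | inside u₁ = refl
  by-role x₃ rewrite before x₁ {x₃} tt | before u₁ {x₃} tt | inside x₃ = refl
  by-role u₂ rewrite before x₁ {u₂} tt | before u₁ {u₂} tt | before x₃ {u₂} tt | inside u₂ = refl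
  by-role x₄ rewrite before x₁ {x₄} tt | before u₁ {x₄} tt | before x₃ {x₄} tt | before u₂ {x₄} tt
                   | inside x₄ = refl

quantifierAbs : Role → Quant
quantifierAbs u₂ = ∀q
quantifierAbs _ = ∃q

ΠA : ℕ → Prefix
ΠA n = Abs (ΠC n) 3

ΠA-graded : ∀ n → Graded grade 1 (ΠA n)
ΠA-graded n = graded-Abs grade (ΠC n) 3 (ΠC-graded n)

block∈ΠA : ∀ n r → (quantifierAbs r , prefixBlock r n) ∈ ΠA n
block∈ΠA n r =
  subst ((quantifierAbs r , prefixBlock r n) ∈_) (sym (cong (λ Π → Abs Π 3) (ΠC-blocks n))) (block∈ r)
  where
  block∈ : ∀ r → (quantifierAbs r , prefixBlock r n) ∈ Abs (ΠC-by-roles n) 3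
  block∈ x₁ = #₀
  block∈ x₂ = #₀
  block∈ u₁ = #₁
  block∈ x₃ = #₂
  block∈ u₂ = #₃
  block∈ x₄ = #₄

quantOf-ΠA : ∀ {n j} → j < n → ∀ r → quantOf (ΠA n) (blockVar j r) ≡ quantifierAbs r
quantOf-ΠA {n} j<n r = graded-quantOf grade (ΠA-graded n) (block∈ΠA n r) (∈-prefixBlock j<n r)

ALit : Set
ALit = Bool × Role

AClause : Set
AClause = List ALit

literalAt : ℕ → ALit → Lit
literalAt j (b , r) = lit (blockVar j r) b

clauseAt : ℕ → AClause → Clause
clauseAt j = map (literalAt j)

pattern +_ r = (true , r)
pattern -_ r = (false , r)

negA : ALit → ALit
negA = map₁ not

var-lit : ∀ v b → var (lit v b) ≡ v
var-lit v true = refl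
var-lit v false = refl

~-literalAt : ∀ j a → ~ literalAt j a ≡ literalAt j (negA a)
~-literalAt j (+ r) = refl
~-literalAt j (- r) = refl

literalAt-injective : ∀ {j k a b} → literalAt j a ≡ literalAt k b → j ≡ k × a ≡ b
literalAt-injective {a = b , r} {c , r′} e with lit-injective e
... | v≡w , refl with blockVar-injective v≡w
...   | refl , refl = refl , refl

clauseAt-injective : ∀ {j c d} → clauseAt j c ≡ clauseAt j d → c ≡ d
clauseAt-injective = List.map-injective (proj₂ ∘ literalAt-injective)

_≟A_ : DecidableEquality ALit
_≟A_ = ×.≡-dec Bool._≟_ _≟R_

_≟AC_ : DecidableEquality AClause
_≟AC_ = List.≡-dec _≟A_

does-≟-injective : ∀ {A B : Set} (_≟A_ : DecidableEquality A) (_≟B_ : DecidableEquality B) {f : A → B} →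
                   (∀ {a b} → f a ≡ f b → a ≡ b) → ∀ a b → does (f a ≟B f b) ≡ does (a ≟A b)
does-≟-injective _≟A_ _≟B_ {f} f-inj a b = does-⇔ (mk⇔ f-inj (cong f)) (f a ≟B f b) (a ≟A b)

⌊≟⌋-injective : ∀ {A B : Set} (_≟A_ : DecidableEquality A) (_≟B_ : DecidableEquality B) {f : A → B} →
                (∀ {a b} → f a ≡ f b → a ≡ b) → ∀ a b → ⌊ f a ≟B f b ⌋ ≡ ⌊ a ≟A b ⌋
⌊≟⌋-injective _≟A_ _≟B_ {f} f-inj a b =
  trans (isYes≗does (f a ≟B f b)) (trans (does-≟-injective _≟A_ _≟B_ f-inj a b) (sym (isYes≗does (a ≟A b))))

_∈ᵇᴬ_ : ALit → AClause → Bool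
a ∈ᵇᴬ c = any (λ b → ⌊ a ≟A b ⌋) c

any-map : ∀ {A B : Set} (p : B → Bool) (f : A → B) xs → any p (map f xs) ≡ any (p ∘ f) xs
any-map p f xs = cong or (sym (map-∘ xs))

any-cong : ∀ {p q : A → Bool} → (∀ a → p a ≡ q a) → ∀ xs → any p xs ≡ any q xs
any-cong p≗q xs = cong or (map-cong p≗q xs)

filter-map : ∀ {A B : Set} {P : B → Set} {Q : A → Set} (P? : Decidable P) (Q? : Decidable Q) {f : A → B} xs →
             All (λ a → does (P? (f a)) ≡ does (Q? a)) xs → filter P? (map f xs) ≡ map f (filter Q? xs)
filter-map P? Q? [] [] = refl
filter-map P? Q? {f} (a ∷ xs) (same ∷ rest) rewrite same with does (Q? a)
... | true = cong (f a ∷_) (filter-map P? Q? xs rest)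
... | false = filter-map P? Q? xs rest

filterᵇ-map : ∀ {A B : Set} (p : B → Bool) (q : A → Bool) {f : A → B} xs →
              All (λ a → p (f a) ≡ q a) xs → filterᵇ p (map f xs) ≡ map f (filterᵇ q xs)
filterᵇ-map p q = filter-map (T? ∘ p) (T? ∘ q)

∈ᵇ-clauseAt : ∀ j a σ → literalAt j a ∈ᵇ clauseAt j σ ≡ a ∈ᵇᴬ σ
∈ᵇ-clauseAt j a σ =
  trans (any-map _ (literalAt j) σ) (any-cong (⌊≟⌋-injective _≟A_ _≟L_ (proj₂ ∘ literalAt-injective) a) σ)

⌊≟⌋-literalAt : ∀ j a b → ⌊ literalAt j a ≟L literalAt j b ⌋ ≡ ⌊ a ≟A b ⌋
⌊≟⌋-literalAt j = ⌊≟⌋-injective _≟A_ _≟L_ (proj₂ ∘ literalAt-injective)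

all-true : ∀ (p : A → Bool) xs → all p xs ≡ true → All (λ a → p a ≡ true) xs
all-true p [] _ = []
all-true p (a ∷ xs) e = ∧-conicalˡ _ _ e ∷ all-true p xs (∧-conicalʳ _ _ e)

satisfiesᴬ : AClause → AClause → Bool
satisfiesᴬ σ c = any (_∈ᵇᴬ σ) c

dropFalsifiedᴬ : AClause → AClause → AClause
dropFalsifiedᴬ σ c = filterᵇ (λ a → not (negA a ∈ᵇᴬ σ)) c

_≤ᴬ_ : ALit → ALit → Bool
a ≤ᴬ b = level (proj₂ a) ≤ᵇ level (proj₂ b)

ORᴬ : AClause → AClause → ALit → AClause
ORᴬ c d a = filterᵇ (λ b → not ⌊ b ≟A a ⌋) c ++ filterᵇ (λ b → (b ≤ᴬ negA a) ∧ not ⌊ b ≟A negA a ⌋) d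

-- _≤ᴬ_ only compares levels, so it agrees with ≤_Π unless a and b are the
-- two distinct roles x₁, x₂ of the first block
comparable : ALit → ALit → Bool
comparable a b = ⌊ proj₂ a ≟R proj₂ b ⌋ ∨ not ⌊ level (proj₂ a) ℕ.≟ level (proj₂ b) ⌋

satisfies-clauseAt : ∀ j σ c → satisfies (clauseAt j σ) (clauseAt j c) ≡ satisfiesᴬ σ c
satisfies-clauseAt j σ c = trans (any-map _ (literalAt j) c) (any-cong (λ a → ∈ᵇ-clauseAt j a σ) c)

dropFalsified-clauseAt : ∀ j σ c →
                         dropFalsified (clauseAt j σ) (clauseAt j c) ≡ clauseAt j (dropFalsifiedᴬ σ c)
dropFalsified-clauseAt j σ c =
  filterᵇ-map (λ k → not ((~ k) ∈ᵇ clauseAt j σ)) (λ a → not (negA a ∈ᵇᴬ σ)) c (All.tabulate λ {a} _ →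
  cong not (trans (cong (_∈ᵇ clauseAt j σ) (~-literalAt j a)) (∈ᵇ-clauseAt j (negA a) σ)))

≤ᵇ-agree : ∀ {m n p q} → m ≢ n → (m < n → p < q) → (n < m → q < p) → (p ≤ᵇ q) ≡ (m ≤ᵇ n)
≤ᵇ-agree {m} {n} {p} {q} m≢n mono mono′ with ℕ.<-cmp m n
... | tri< m<n _ _ = trans (dec-true (p ℕ.≤? q) (ℕ.<⇒≤ (mono m<n))) (sym (dec-true (m ℕ.≤? n) (ℕ.<⇒≤ m<n)))
... | tri≈ _ m≡n _ = ⊥-elim (m≢n m≡n)
... | tri> _ _ n<m = trans (dec-false (p ℕ.≤? q) (ℕ.<⇒≱ (mono′ n<m))) (sym (dec-false (m ℕ.≤? n) (ℕ.<⇒≱ n<m)))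

≤Π-literalAt : ∀ {n j} → j < n → ∀ a b → comparable a b ≡ true →
               (literalAt j a ≤[ ΠC n ] literalAt j b) ≡ a ≤ᴬ b
≤Π-literalAt {n} {j} j<n (s , r) (s′ , r′) cmp
  rewrite var-lit (blockVar j r) s | var-lit (blockVar j r′) s′ with r ≟R r′
... | yes refl = trans (dec-true (p ℕ.≤? p) ℕ.≤-refl) (sym (dec-true (level r ℕ.≤? level r) ℕ.≤-refl))
  where p = position (qvars (ΠC n)) (blockVar j r)
... | no _ with level r ℕ.≟ level r′
...   | yes _ = case cmp of λ ()
...   | no r≢r′ = ≤ᵇ-agree r≢r′ (position-ΠC j<n) (position-ΠC j<n)

OR-clauseAt : ∀ {n j} → j < n → ∀ c d a → all (λ b → comparable b (negA a)) d ≡ true →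
              OR (ΠC n) (clauseAt j c) (clauseAt j d) (literalAt j a) ≡ clauseAt j (ORᴬ c d a)
OR-clauseAt {n} {j} j<n c d a cmp =
  trans (cong₂ _++_ resolvent-side outer-side)
        (sym (map-++ (literalAt j) (filterᵇ (λ b → not ⌊ b ≟A a ⌋) c)
                                   (filterᵇ (λ b → (b ≤ᴬ negA a) ∧ not ⌊ b ≟A negA a ⌋) d)))
  where
  resolvent-side = filterᵇ-map (λ k → not ⌊ k ≟L literalAt j a ⌋) (λ b → not ⌊ b ≟A a ⌋) c
                     (All.tabulate λ {b} _ → cong not (⌊≟⌋-literalAt j b a))
  outer-side =
    trans (cong (OC (ΠC n) (clauseAt j d)) (~-literalAt j a))
          (filterᵇ-map (λ k → (k ≤[ ΠC n ] literalAt j (negA a)) ∧ not ⌊ k ≟L literalAt j (negA a) ⌋)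
                       (λ b → (b ≤ᴬ negA a) ∧ not ⌊ b ≟A negA a ⌋) d
                       (All.map (λ {b} b-cmp → cong₂ _∧_ (≤Π-literalAt j<n b (negA a) b-cmp)
                                                          (cong not (⌊≟⌋-literalAt j b (negA a))))
                                (all-true _ d cmp)))

c₀ c₁ c₂ c₃ c₄ c₅ c₆ : AClause
c₀ = + x₁ ∷ + u₁ ∷ - x₃ ∷ []
c₁ = + x₂ ∷ - u₁ ∷ + x₃ ∷ []
c₂ = - x₁ ∷ - u₁ ∷ - x₃ ∷ []
c₃ = - x₂ ∷ + u₁ ∷ + x₃ ∷ []
c₄ = + u₁ ∷ - x₃ ∷ + x₄ ∷ []
c₅ = - u₂ ∷ - x₄ ∷ []
c₆ = - x₁ ∷ + u₂ ∷ - x₄ ∷ []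

blockClauses : List AClause
blockClauses = c₀ ∷ c₁ ∷ c₂ ∷ c₃ ∷ c₄ ∷ c₅ ∷ c₆ ∷ []

∈-ψC⁻ : ∀ {n C} → C ∈ ψC n → ∃[ k ] k < n × ∃[ c ] c ∈ blockClauses × C ≡ clauseAt k c
∈-ψC⁻ C∈ with find (∈.∈-concatMap⁻ clausesC C∈)
... | k , k∈ , C∈k with ∈.∈-map⁻ (clauseAt k) C∈k
...   | c , c∈ , refl = k , ∈.∈-upTo⁻ k∈ , c , c∈ , refl

∈-ψC⁺ : ∀ {n j c} → j < n → c ∈ blockClauses → clauseAt j c ∈ ψC n
∈-ψC⁺ {j = j} j<n c∈ = ∈.∈-concatMap⁺ clausesC (lose (∈.∈-upTo⁺ j<n) (∈.∈-map⁺ (clauseAt j) c∈))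

existential : Role → Bool
existential u₁ = false
existential u₂ = false
existential _ = true

isExistential-literalAt : ∀ {n j} → j < n → ∀ a → isExistential (ΠC n) (literalAt j a) ≡ existential (proj₂ a)
isExistential-literalAt {n} {j} j<n (b , r) =
  by-role r (trans (cong (quantOf (ΠC n)) (var-lit (blockVar j r) b)) (quantOf-ΠC j<n r))
  where
  by-role : ∀ r → quantOf (ΠC n) (var (literalAt j (b , r))) ≡ quantifier r →
            isExistential (ΠC n) (literalAt j (b , r)) ≡ existential r
  by-role x₁ q rewrite q = refl
  by-role x₂ q rewrite q = refl
  by-role x₃ q rewrite q = refl
  by-role x₄ q rewrite q = refl
  by-role u₁ q rewrite q = refl
  by-role u₂ q rewrite q = refl

-- (b) No clause has QRAT

valueᴬ : (Role → Bool) → ALit → Bool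
valueᴬ T (+ r) = T r
valueᴬ T (- r) = not (T r)

extendBlock : ℕ → (Role → Bool) → Var → Bool
extendBlock j T v = if proj₁ (decode v) ≡ᵇ j then T (proj₂ (decode v)) else false

extendBlock-here : ∀ j T r → extendBlock j T (blockVar j r) ≡ T r
extendBlock-here j T r rewrite decode-blockVar j r | dec-true (j ℕ.≟ j) refl = refl

extendBlock-elsewhere : ∀ {j k} T r → k ≢ j → extendBlock j T (blockVar k r) ≡ false
extendBlock-elsewhere {j} {k} T r k≢j rewrite decode-blockVar k r | dec-false (k ℕ.≟ j) k≢j = refl

value-literalAt : ∀ j T a → value (extendBlock j T) (literalAt j a) ≡ valueᴬ T a
value-literalAt j T (+ r) = extendBlock-here j T r
value-literalAt j T (- r) = cong not (extendBlock-here j T r)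

negative-literal : ∀ {c} → c ∈ blockClauses → ∃[ r ] - r ∈ c
negative-literal {c} c∈
  with find (Any.any⁻ (not ∘ proj₁) c
               (Equivalence.from T-≡ (All.lookup (all-true (any (not ∘ proj₁)) blockClauses refl) c∈)))
... | - r , r∈c , _ = r , r∈c

_⊨ᴬ_ : (Role → Bool) → AClause → Bool
T ⊨ᴬ c = any (valueᴬ T) c

⊨-clauseAt : ∀ j T c → (T ⊨ᴬ c) ≡ true → extendBlock j T ⊨ clauseAt j c
⊨-clauseAt j T c sat =
  Any.map⁺ (Any.map (λ {a} t → trans (value-literalAt j T a) (Equivalence.to T-≡ t))
                    (Any.any⁻ _ c (Equivalence.from T-≡ sat)))

-- T refutes c on a with partner d ∋ ¬a: it satisfies every clause of the
-- block other than c and falsifies their outer resolvent.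
Refutation : AClause → ALit → AClause → (Role → Bool) → Bool
Refutation c a d T =
  any (λ d′ → ⌊ d ≟AC d′ ⌋) blockClauses ∧ negA a ∈ᵇᴬ d ∧ not ⌊ d ≟AC c ⌋
  ∧ all (λ c′ → ⌊ c′ ≟AC c ⌋ ∨ (T ⊨ᴬ c′)) blockClauses
  ∧ all (λ b → comparable b (negA a)) d
  ∧ all (not ∘ valueᴬ T) (ORᴬ c d a)

∧-split : ∀ {x y} → x ∧ y ≡ true → x ≡ true × y ≡ true
∧-split {b} {b′} e = ∧-conicalˡ b b′ e , ∧-conicalʳ b b′ e

¬QRAT-by-refutation : ∀ {n j} → j < n → ∀ c a d T → Refutation c a d T ≡ true →
                      ¬ QRAT (ΠC n) (ψC n ∖[ clauseAt j c ]) (clauseAt j c) (literalAt j a)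
¬QRAT-by-refutation {n} {j} j<n c a d T refutation with ∧-split refutation
... | d∈ , r₁ with ∧-split r₁
... | ¬a∈d , r₂ with ∧-split r₂
... | d≢c , r₃ with ∧-split r₃
... | others , r₄ with ∧-split r₄
... | resolvable , falsified = λ qrat →
  ¬AT-of-countermodel τ satisfied E-falsified (qrat (clauseAt j d) D∈χ ~l∈D)
  where
  τ = extendBlock j T

  D∈χ : clauseAt j d ∈ ψC n ∖[ clauseAt j c ]
  D∈χ = ∈.∈-filter⁺ (λ D → ¬? (D ≟C clauseAt j c)) (∈-ψC⁺ j<n (any-≟⇒∈ _≟AC_ d∈))
          (toWitnessFalse {a? = d ≟AC c} (Equivalence.from T-≡ d≢c) ∘ clauseAt-injective {j})

  ~l∈D : ~ literalAt j a ∈ clauseAt j d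
  ~l∈D = subst (_∈ clauseAt j d) (sym (~-literalAt j a)) (∈.∈-map⁺ (literalAt j) (any-≟⇒∈ _≟A_ ¬a∈d))

  satisfied-here : ∀ {c′} → c′ ∈ blockClauses → c′ ≢ c → (T ⊨ᴬ c′) ≡ true
  satisfied-here {c′} c′∈ c′≢c =
    subst (λ b → b ∨ (T ⊨ᴬ c′) ≡ true) (trans (isYes≗does (c′ ≟AC c)) (dec-false (c′ ≟AC c) c′≢c))
          (All.lookup (all-true (λ c′ → ⌊ c′ ≟AC c ⌋ ∨ (T ⊨ᴬ c′)) blockClauses others) c′∈)

  satisfied : All (τ ⊨_) (ψC n ∖[ clauseAt j c ])
  satisfied = All.tabulate λ C′∈χ →
    case ∈.∈-filter⁻ (λ D → ¬? (D ≟C clauseAt j c)) {xs = ψC n} C′∈χ of λ where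
      (C′∈ψ , C′≢C) → case ∈-ψC⁻ {n} C′∈ψ of λ where
        (k , _ , c′ , c′∈ , refl) → case k ℕ.≟ j of λ where
          (yes refl) → ⊨-clauseAt j T c′ (satisfied-here c′∈ (C′≢C ∘ cong (clauseAt j)))
          (no k≢j) → let r , neg∈c′ = negative-literal c′∈ in
                     lose (∈.∈-map⁺ (literalAt k) neg∈c′) (cong not (extendBlock-elsewhere T r k≢j))

  E-falsified : All (λ k → value τ k ≡ false) (OR (ΠC n) (clauseAt j c) (clauseAt j d) (literalAt j a))
  E-falsified = subst (All (λ k → value τ k ≡ false)) (sym (OR-clauseAt j<n c d a resolvable)) $
    All.map⁺ (All.map (λ {b} f → trans (value-literalAt j T b)
                                         (Equivalence.to T-not-≡ (Equivalence.from T-≡ f)))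
                      (all-true _ (ORᴬ c d a) falsified))

valuation : Bool → Bool → Bool → Bool → Bool → Bool → Role → Bool
valuation b₁ b₂ b₃ b₄ b₅ b₆ x₁ = b₁
valuation b₁ b₂ b₃ b₄ b₅ b₆ x₂ = b₂
valuation b₁ b₂ b₃ b₄ b₅ b₆ x₃ = b₃
valuation b₁ b₂ b₃ b₄ b₅ b₆ x₄ = b₄
valuation b₁ b₂ b₃ b₄ b₅ b₆ u₁ = b₅
valuation b₁ b₂ b₃ b₄ b₅ b₆ u₂ = b₆

¬QRAT-in-block : ∀ {n j} → j < n → ∀ {c a} → c ∈ blockClauses → a ∈ c → existential (proj₂ a) ≡ true →
                 ¬ QRAT (ΠC n) (ψC n ∖[ clauseAt j c ]) (clauseAt j c) (literalAt j a)
¬QRAT-in-block j<n #₀ #₀ _ = ¬QRAT-by-refutation j<n c₀ (+ x₁) c₆ (valuation false false true  true  false false) refl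
¬QRAT-in-block j<n #₀ #₁ ()
¬QRAT-in-block j<n #₀ #₂ _ = ¬QRAT-by-refutation j<n c₀ (- x₃) c₃ (valuation false true  true  true  false false) refl
¬QRAT-in-block j<n #₁ #₀ _ = ¬QRAT-by-refutation j<n c₁ (+ x₂) c₃ (valuation false false false false true  false) refl
¬QRAT-in-block j<n #₁ #₁ ()
¬QRAT-in-block j<n #₁ #₂ _ = ¬QRAT-by-refutation j<n c₁ (+ x₃) c₂ (valuation true  false false false true  false) refl
¬QRAT-in-block j<n #₂ #₀ _ = ¬QRAT-by-refutation j<n c₂ (- x₁) c₀ (valuation false false true  false true  false) refl
¬QRAT-in-block j<n #₂ #₁ ()
¬QRAT-in-block j<n #₂ #₂ _ = ¬QRAT-by-refutation j<n c₂ (- x₃) c₁ (valuation true  false true  false true  false) refl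
¬QRAT-in-block j<n #₃ #₀ _ = ¬QRAT-by-refutation j<n c₃ (- x₂) c₁ (valuation false false false false false false) refl
¬QRAT-in-block j<n #₃ #₁ ()
¬QRAT-in-block j<n #₃ #₂ _ = ¬QRAT-by-refutation j<n c₃ (+ x₃) c₀ (valuation false true  false false false false) refl
¬QRAT-in-block j<n #₄ #₀ ()
¬QRAT-in-block j<n #₄ #₁ _ = ¬QRAT-by-refutation j<n c₄ (- x₃) c₃ (valuation true  true  true  false false false) refl
¬QRAT-in-block j<n #₄ #₂ _ = ¬QRAT-by-refutation j<n c₄ (+ x₄) c₅ (valuation true  false true  false false true ) refl
¬QRAT-in-block j<n #₅ #₀ ()
¬QRAT-in-block j<n #₅ #₁ _ = ¬QRAT-by-refutation j<n c₅ (- x₄) c₄ (valuation true  false true  true  false true ) refl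
¬QRAT-in-block j<n #₆ #₀ _ = ¬QRAT-by-refutation j<n c₆ (- x₁) c₀ (valuation true  false true  true  false false) refl
¬QRAT-in-block j<n #₆ #₁ ()
¬QRAT-in-block j<n #₆ #₂ _ = ¬QRAT-by-refutation j<n c₆ (- x₄) c₄ (valuation true  false true  true  false false) refl

no-QRATE : ∀ n → ¬ QRATE-eliminable (ΠC n) (ψC n)
no-QRATE n (C , l , C∈ψ , l∈C , l-existential , qrat) with ∈-ψC⁻ C∈ψ
... | j , j<n , c , c∈ , refl with ∈.∈-map⁻ (literalAt j) l∈C
...   | a , a∈c , refl =
  ¬QRAT-in-block {n} j<n c∈ a∈c (trans (sym (isExistential-literalAt j<n a)) l-existential) qrat

-- (a) Elimination by QRATE⁺

blockCNF : ℕ → List AClause → CNF → CNF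
blockCNF j cs rest = map (clauseAt j) cs ++ rest

Foreign : ℕ → CNF → Set
Foreign j rest = All (λ D → ∀ a → literalAt j a ∉ D) rest

remove : AClause → List AClause → List AClause
remove c cs = filter (λ d → ¬? (d ≟AC c)) cs

∖-blockCNF : ∀ {j rest a} c cs → Foreign j rest → a ∈ c →
             blockCNF j cs rest ∖[ clauseAt j c ] ≡ blockCNF j (remove c cs) rest
∖-blockCNF {j} {rest} {a} c cs foreign a∈c =
  trans (filter-++ P? (map (clauseAt j) cs) rest)
        (cong₂ _++_ (filter-map P? (λ d → ¬? (d ≟AC c)) cs
                       (All.tabulate λ {d} _ →
                          cong not (does-≟-injective _≟AC_ _≟C_ (clauseAt-injective {j}) d c)))
                    (filter-all P? (All.map (λ a∉D D≡C →
                                               a∉D a (subst (literalAt j a ∈_) (sym D≡C) (∈.∈-map⁺ _ a∈c)))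
                                            foreign)))
  where
  P? = λ D → ¬? (D ≟C clauseAt j c)

eliminate : ∀ {n j rest} → j < n → Foreign j rest → ∀ cs c a cs′ → c ∈ cs → a ∈ c →
            existential (proj₂ a) ≡ true → remove c cs ≡ cs′ →
            QRAT⁺ (ΠC n) (blockCNF j cs′ rest) (clauseAt j c) (literalAt j a) →
            QRATE⁺-step (ΠC n) (blockCNF j cs rest) (blockCNF j cs′ rest)
eliminate {n} {j} {rest} j<n foreign cs c a cs′ c∈cs a∈c a-existential refl qrat⁺ =
  subst (QRATE⁺-step (ΠC n) (blockCNF j cs rest)) removed
    (step (clauseAt j c) (literalAt j a) (∈.∈-++⁺ˡ (∈.∈-map⁺ (clauseAt j) c∈cs)) (∈.∈-map⁺ (literalAt j) a∈c)
          (trans (isExistential-literalAt j<n a) a-existential)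
          (subst (λ χ → QRAT⁺ (ΠC n) χ (clauseAt j c) (literalAt j a)) (sym removed) qrat⁺))
  where
  removed = ∖-blockCNF c cs foreign a∈c

resolution-partner : ∀ {j rest cs a D} → Foreign j rest → D ∈ blockCNF j cs rest → ~ literalAt j a ∈ D →
                     ∃[ d ] d ∈ cs × negA a ∈ d × D ≡ clauseAt j d
resolution-partner {j} {cs = cs} {a} foreign D∈ ~l∈D with ∈.∈-++⁻ (map (clauseAt j) cs) D∈
... | inj₂ D∈rest = ⊥-elim (All.lookup foreign D∈rest (negA a) (subst (_∈ _) (~-literalAt j a) ~l∈D))
... | inj₁ D∈block with ∈.∈-map⁻ (clauseAt j) D∈block
...   | d , d∈cs , refl with ∈.∈-map⁻ (literalAt j) (subst (_∈ clauseAt j d) (~-literalAt j a) ~l∈D)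
...     | b , b∈d , ¬a≡b = d , d∈cs , subst (_∈ d) (sym (proj₂ (literalAt-injective ¬a≡b))) b∈d , refl

QRAT⁺-blockCNF : ∀ {n j rest cs C a} → Foreign j rest →
                 (∀ {d} → d ∈ cs → negA a ∈ d →
                    QAT (ΠC n) (OR (ΠC n) C (clauseAt j d) (literalAt j a)) (blockCNF j cs rest)) →
                 QRAT⁺ (ΠC n) (blockCNF j cs rest) C (literalAt j a)
QRAT⁺-blockCNF {n} {j} {rest} {cs} {C} {a} foreign partner D D∈ ~l∈D =
  let d , d∈cs , ¬a∈d , D≡d = resolution-partner foreign D∈ ~l∈D in
  subst (λ D → QAT (ΠC n) (OR (ΠC n) C D (literalAt j a)) (blockCNF j cs rest)) (sym D≡d) (partner d∈cs ¬a∈d)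

QRAT⁺-vacuous : ∀ {n j rest cs C a} → Foreign j rest → all (λ d → not (negA a ∈ᵇᴬ d)) cs ≡ true →
                QRAT⁺ (ΠC n) (blockCNF j cs rest) C (literalAt j a)
QRAT⁺-vacuous {n} {j} {rest} {cs} {C} {a} foreign none =
  QRAT⁺-blockCNF {n} {j} {rest} {cs} {C} {a} foreign λ d∈cs ¬a∈d →
    case trans (sym (All.lookup (all-true (λ d → not (negA a ∈ᵇᴬ d)) cs none) d∈cs))
               (cong not (∈⇒any-≟ _≟A_ ¬a∈d)) of λ ()

eliminate-vacuous : ∀ {n j rest} → j < n → Foreign j rest → ∀ cs c a cs′ → c ∈ cs → a ∈ c →
                    existential (proj₂ a) ≡ true → remove c cs ≡ cs′ →
                    all (λ d → not (negA a ∈ᵇᴬ d)) cs′ ≡ true →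
                    QRATE⁺-step (ΠC n) (blockCNF j cs rest) (blockCNF j cs′ rest)
eliminate-vacuous {n} {j} {rest} j<n foreign cs c a cs′ c∈cs a∈c a-existential removed none =
  eliminate j<n foreign cs c a cs′ c∈cs a∈c a-existential removed
    (QRAT⁺-vacuous {n} {j} {rest} {cs′} {clauseAt j c} {a} foreign none)

QAT-at : ∀ {Π E χ} i → maxLevel Π E ≡ i → QUP⊥ (Abs Π i) (χ ++ negUnits E) →
         Abs Π i ∙ χ ⊨t (χ ++ E ∷ []) → QAT Π E χ
QAT-at i refl derivation entailment = derivation , entailment

maxLevel-clauseAt : ∀ {n j} → j < n → ∀ e →
                    maxLevel (ΠC n) (clauseAt j e) ≡ foldr (λ a m → level (proj₂ a) ⊔ m) 0 e
maxLevel-clauseAt j<n [] = refl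
maxLevel-clauseAt {n} {j} j<n ((b , r) ∷ e) =
  cong₂ _⊔_ (trans (cong (blockOf (ΠC n)) (var-lit (blockVar j r) b)) (blockOf-ΠC j<n r))
            (maxLevel-clauseAt j<n e)

UR-existential : ∀ Π k → quantOf Π (var k) ≡ ∃q → UR Π [ k ] ≡ [ k ]
UR-existential Π k q rewrite q = refl

UR-universal : ∀ Π k → quantOf Π (var k) ≡ ∀q → UR Π [ k ] ≡ []
UR-universal Π k q rewrite q = refl

all-++-[] : ∀ (p : A → Bool) xs {y} → all p xs ≡ true → p y ≡ true → all p (xs ++ y ∷ []) ≡ true
all-++-[] p [] _ py = cong (_∧ true) py
all-++-[] p (a ∷ xs) pxs py = cong₂ _∧_ (∧-conicalˡ _ _ pxs) (all-++-[] p xs (∧-conicalʳ _ _ pxs) py)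

satisfiesCNF-∷ʳ : ∀ {σ} χ {E} → satisfiesCNF σ χ ≡ true → satisfies σ E ≡ true →
                  satisfiesCNF σ (χ ++ E ∷ []) ≡ true
satisfiesCNF-∷ʳ {σ} χ = all-++-[] (satisfies σ) χ

satisfiesCNF-∈ : ∀ {σ χ C} → satisfiesCNF σ χ ≡ true → C ∈ χ → satisfies σ C ≡ true
satisfiesCNF-∈ {σ} {χ} sat C∈χ = All.lookup (all-true (satisfies σ) χ sat) C∈χ

resolvent₀ resolvent₁ : AClause
resolvent₀ = + u₁ ∷ - x₃ ∷ []
resolvent₁ = + x₂ ∷ - u₁ ∷ + u₁ ∷ []

module BlockElimination {n j rest} (j<n : j < n) (foreign : Foreign j rest) where

  ∈-blockCNF : ∀ cs {d} → d ∈ cs → clauseAt j d ∈ blockCNF j cs rest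
  ∈-blockCNF cs d∈ = ∈.∈-++⁺ˡ (∈.∈-map⁺ (clauseAt j) d∈)

  below-u₂ : ∀ r → T (level r <ᵇ level u₂) →
             blockVar j r ∈ vars (qvars (ΠA n)) × grade (blockVar j r) < grade (blockVar j u₂)
  below-u₂ r r<u₂ =
    ∈-vars (∈-qvars (block∈ΠA n r) (∈-prefixBlock j<n r)) ,
    subst₂ _<_ (sym (grade-blockVar j r)) (sym (grade-blockVar j u₂)) (ℕ.<ᵇ⇒< (level r) (level u₂) r<u₂)

  S₁ S₂ S₃ S₄ S₅ S₆ : List AClause
  S₁ = c₁ ∷ c₂ ∷ c₃ ∷ c₄ ∷ c₅ ∷ c₆ ∷ []
  S₂ = c₁ ∷ c₃ ∷ c₄ ∷ c₅ ∷ c₆ ∷ []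
  S₃ = c₃ ∷ c₄ ∷ c₅ ∷ c₆ ∷ []
  S₄ = c₄ ∷ c₅ ∷ c₆ ∷ []
  S₅ = c₅ ∷ c₆ ∷ []
  S₆ = c₆ ∷ []

  χ₁ χ₃ : CNF
  χ₁ = blockCNF j S₁ rest
  χ₃ = blockCNF j S₃ rest

  QUP-resolvent₀ : QUP⊥ (ΠA n) (χ₁ ++ negUnits (clauseAt j resolvent₀))
  QUP-resolvent₀ =
    unit (∈.∈-++⁺ʳ χ₁ #₀) refl (UR-existential (ΠA n) _ (quantOf-ΠA j<n u₁))
    (unit (∈.∈-++⁺ʳ χ₁ #₁) refl (UR-existential (ΠA n) _ (quantOf-ΠA j<n x₃))
    (unit (∈.∈-++⁺ˡ (∈-blockCNF S₁ #₃)) (satisfies-clauseAt j σ₂ c₄)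
          (trans (cong (UR (ΠA n)) (dropFalsified-clauseAt j σ₂ c₄))
                 (UR-existential (ΠA n) _ (quantOf-ΠA j<n x₄)))
    (conflict (∈.∈-++⁺ˡ (∈-blockCNF S₁ #₄)) (satisfies-clauseAt j σ₃ c₅)
          (trans (cong (UR (ΠA n)) (dropFalsified-clauseAt j σ₃ c₅))
                 (UR-universal (ΠA n) _ (quantOf-ΠA j<n u₂))))))
    where
    σ₂ σ₃ : AClause
    σ₂ = + x₃ ∷ - u₁ ∷ []
    σ₃ = + x₄ ∷ σ₂

  ⊨-resolvent₀ : ΠA n ∙ χ₁ ⊨t (χ₁ ++ clauseAt j resolvent₀ ∷ [])
  ⊨-resolvent₀ t model =
    AllPaths-map (λ {σ} (χ-sat , E-sat) → satisfiesCNF-∷ʳ {σ} χ₁ χ-sat E-sat) t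
      (AllPaths-zip t model
        (universal-reduction-graded grade {E = clauseAt j resolvent₀} (ΠA-graded n)
           (∈-qvars (block∈ΠA n u₂) (∈-prefixBlock j<n u₂)) (below-u₂ u₁ tt ∷ below-u₂ x₃ tt ∷ []) refuted t
           (AllPaths-zip t model (AllPaths-consistent t (graded-unique grade (ΠA-graded n))))))
    where
    refuted : ∀ {σ} → satisfiesCNF σ χ₁ ≡ true × Consistent σ →
              All (λ l → ~ l ∈ σ) (clauseAt j resolvent₀) → pos (blockVar j u₂) ∈ σ → ⊥
    refuted {σ} (χ-sat , consistent) (¬u₁∈ ∷ x₃∈ ∷ []) u₂∈
      with satisfies-∃ (clauseAt j c₄) (satisfiesCNF-∈ {σ} χ-sat (∈-blockCNF S₁ #₃))
    ... | _ , #₀ , u₁∈ = consistent u₁∈ ¬u₁∈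
    ... | _ , #₁ , ¬x₃∈ = consistent x₃∈ ¬x₃∈
    ... | _ , #₂ , x₄∈ with satisfies-∃ (clauseAt j c₅) (satisfiesCNF-∈ {σ} χ-sat (∈-blockCNF S₁ #₄))
    ...   | _ , #₀ , ¬u₂∈ = consistent u₂∈ ¬u₂∈
    ...   | _ , #₁ , ¬x₄∈ = consistent x₄∈ ¬x₄∈


  QUP-resolvent₁ : QUP⊥ (ΠA n) (χ₃ ++ negUnits (clauseAt j resolvent₁))
  QUP-resolvent₁ =
    unit (∈.∈-++⁺ʳ χ₃ #₁) refl (UR-existential (ΠA n) _ (quantOf-ΠA j<n u₁))
    (conflict (∈.∈-++⁺ʳ χ₃ #₂) refl (cong (UR (ΠA n)) (dropFalsified-clauseAt j (+ u₁ ∷ []) (- u₁ ∷ []))))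

  ⊨-resolvent₁ : ΠA n ∙ χ₃ ⊨t (χ₃ ++ clauseAt j resolvent₁ ∷ [])
  ⊨-resolvent₁ t model =
    AllPaths-map (λ {σ} (χ-sat , u₁-assigned) → satisfiesCNF-∷ʳ {σ} χ₃ χ-sat (decided u₁-assigned)) t
      (AllPaths-zip t model (AllPaths-assigned t (inj₁ (proj₁ (below-u₂ u₁ tt)))))
    where
    decided : ∀ {σ} → Assigned (blockVar j u₁) σ → satisfies σ (clauseAt j resolvent₁) ≡ true
    decided {σ} (true , u₁∈) = satisfies-∈ {σ} {clauseAt j resolvent₁} #₂ u₁∈
    decided {σ} (false , ¬u₁∈) = satisfies-∈ {σ} {clauseAt j resolvent₁} #₁ ¬u₁∈

  QAT-resolvent₀ : QAT (ΠC n) (clauseAt j resolvent₀) χ₁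
  QAT-resolvent₀ =
    QAT-at {ΠC n} {clauseAt j resolvent₀} {χ₁} 3 (maxLevel-clauseAt j<n resolvent₀) QUP-resolvent₀ ⊨-resolvent₀

  -- Abs (ΠC n) 2 is ΠA n, block B₃ being existential already
  QAT-resolvent₁ : QAT (ΠC n) (clauseAt j resolvent₁) χ₃
  QAT-resolvent₁ =
    QAT-at {ΠC n} {clauseAt j resolvent₁} {χ₃} 2 (maxLevel-clauseAt j<n resolvent₁) QUP-resolvent₁ ⊨-resolvent₁

  QRAT⁺-c₀ : QRAT⁺ (ΠC n) χ₁ (clauseAt j c₀) (literalAt j (+ x₁))
  QRAT⁺-c₀ = QRAT⁺-blockCNF {n} {j} {rest} {S₁} {clauseAt j c₀} {+ x₁} foreign partner
    where
    partner : ∀ {d} → d ∈ S₁ → - x₁ ∈ d →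
              QAT (ΠC n) (OR (ΠC n) (clauseAt j c₀) (clauseAt j d) (literalAt j (+ x₁))) χ₁
    partner #₁ _ = subst (λ E → QAT (ΠC n) E χ₁) (sym computed) QAT-resolvent₀
      where
      computed : OR (ΠC n) (clauseAt j c₀) (clauseAt j c₂) (literalAt j (+ x₁)) ≡ clauseAt j resolvent₀
      computed = OR-clauseAt j<n c₀ c₂ (+ x₁) refl
    partner #₅ _ = subst (λ E → QAT (ΠC n) E χ₁) (sym computed) QAT-resolvent₀
      where
      computed : OR (ΠC n) (clauseAt j c₀) (clauseAt j c₆) (literalAt j (+ x₁)) ≡ clauseAt j resolvent₀
      computed = OR-clauseAt j<n c₀ c₆ (+ x₁) refl
    partner #₀ ¬x₁∈ = ⊥-elim (case ∈⇒any-≟ _≟A_ ¬x₁∈ of λ ())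
    partner #₂ ¬x₁∈ = ⊥-elim (case ∈⇒any-≟ _≟A_ ¬x₁∈ of λ ())
    partner #₃ ¬x₁∈ = ⊥-elim (case ∈⇒any-≟ _≟A_ ¬x₁∈ of λ ())
    partner #₄ ¬x₁∈ = ⊥-elim (case ∈⇒any-≟ _≟A_ ¬x₁∈ of λ ())

  QRAT⁺-c₁ : QRAT⁺ (ΠC n) χ₃ (clauseAt j c₁) (literalAt j (+ x₃))
  QRAT⁺-c₁ = QRAT⁺-blockCNF {n} {j} {rest} {S₃} {clauseAt j c₁} {+ x₃} foreign partner
    where
    partner : ∀ {d} → d ∈ S₃ → - x₃ ∈ d →
              QAT (ΠC n) (OR (ΠC n) (clauseAt j c₁) (clauseAt j d) (literalAt j (+ x₃))) χ₃
    partner #₁ _ = subst (λ E → QAT (ΠC n) E χ₃) (sym computed) QAT-resolvent₁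
      where
      computed : OR (ΠC n) (clauseAt j c₁) (clauseAt j c₄) (literalAt j (+ x₃)) ≡ clauseAt j resolvent₁
      computed = OR-clauseAt j<n c₁ c₄ (+ x₃) refl
    partner #₀ ¬x₃∈ = ⊥-elim (case ∈⇒any-≟ _≟A_ ¬x₃∈ of λ ())
    partner #₂ ¬x₃∈ = ⊥-elim (case ∈⇒any-≟ _≟A_ ¬x₃∈ of λ ())
    partner #₃ ¬x₃∈ = ⊥-elim (case ∈⇒any-≟ _≟A_ ¬x₃∈ of λ ())

  eliminate-block : ΠC n ⊢ blockCNF j blockClauses rest ⟶* rest
  eliminate-block =
    eliminate         j<n foreign blockClauses c₀ (+ x₁) S₁ #₀ #₀ refl refl QRAT⁺-c₀ ◅
    eliminate-vacuous j<n foreign S₁ c₂ (- x₁) S₂ #₁ #₀ refl refl refl ◅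
    eliminate         j<n foreign S₂ c₁ (+ x₃) S₃ #₀ #₂ refl refl QRAT⁺-c₁ ◅
    eliminate-vacuous j<n foreign S₃ c₃ (- x₂) S₄ #₀ #₀ refl refl refl ◅
    eliminate-vacuous j<n foreign S₄ c₄ (- x₃) S₅ #₀ #₁ refl refl refl ◅
    eliminate-vacuous j<n foreign S₅ c₅ (- x₄) S₆ #₀ #₁ refl refl refl ◅
    eliminate-vacuous j<n foreign S₆ c₆ (- x₁) [] #₀ #₀ refl refl refl ◅ ε

foreign-to-other-blocks : ∀ {j is} → All (j ≢_) is → Foreign j (concatMap clausesC is)
foreign-to-other-blocks {j} {is} j∉is = All.tabulate λ D∈ a l∈D →
  case find (∈.∈-concatMap⁻ clausesC {xs = is} D∈) of λ where
    (k , k∈is , D∈k) → case ∈.∈-map⁻ (clauseAt k) {xs = blockClauses} D∈k of λ where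
      (c , _ , refl) → case ∈.∈-map⁻ (literalAt k) l∈D of λ where
        (b , _ , l≡) → All.lookup j∉is k∈is (proj₁ (literalAt-injective l≡))

eliminate-blocks : ∀ {n} is → Unique is → All (_< n) is → ΠC n ⊢ concatMap clausesC is ⟶* []
eliminate-blocks [] _ _ = ε
eliminate-blocks (j ∷ is) (j∉is ∷ unique) (j<n ∷ is<n) =
  BlockElimination.eliminate-block j<n (foreign-to-other-blocks j∉is) ◅◅
  eliminate-blocks is unique is<n

proposition4 : (n : ℕ) → 1 ≤ n →
    (ΠC n ⊢ ψC n ⟶* []) × ¬ QRATE-eliminable (ΠC n) (ψC n)
proposition4 n _ = eliminate-blocks (upTo n) (Unique.upTo⁺ n) (All.tabulate ∈.∈-upTo⁻) , no-QRATE n
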